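{- Let $v=ab$ with $a,b\in\mathbb{N}$. For any integers $k_1,k_2$ with $1\le k_1\le b-1$ and $1\le k_2\le a-1$, there exists a non-disjoint $(v,2,k_1a,k_2b)$-GPSEDF in $\mathbb{Z}_v$.
   Context: For subsets $A,B$ of an additively written group $G$, $\Delta(A,B)$ denotes the multiset $\{a-b:a\in A,b\in B\}$ (one entry per pair). For $\lambda\in\mathbb{N}\cup\{0\}$, $\lambda G$ is the multiset containing every element of $G$ exactly $\lambda$ times. Let $|G|=v$. A family of sets $\{A_1,\dots,A_m\}$ in $G$ with $|A_i|=k_i$ is a non-disjoint $(v,m,k_1,\dots,k_m)$-GPSEDF if $\Delta(A_i,A_j)=\lambda_{i,j}G$ with $\lambda_{i,j}=k_ik_j/v$ for all $1\le i\ne j\le m$. -}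

module Defs where

open import Data.Nat using (ℕ; _+_; _*_; _∸_; NonZero)
open import Data.Nat.DivMod using (_mod_; _/_)
open import Data.Fin using (Fin; toℕ)
open import Data.Fin.Properties using (_≟_)
open import Data.List using (List; length; filter; cartesianProduct)
open import Data.List.Relation.Unary.Unique.Propositional using (Unique)
open import Data.Product using (_×_; proj₁; proj₂)
open import Relation.Binary.PropositionalEquality using (_≡_; _≢_)

-- The cyclic group ℤ_v is modelled as Fin v; subtraction modulo v.
_⊖_ : {v : ℕ} → .{{_ : NonZero v}} → Fin v → Fin v → Fin v
_⊖_ {v} x y = (toℕ x + (v ∸ toℕ y)) mod v

-- Multiplicity of g in the multiset Δ(A,B) = {a - b : a ∈ A, b ∈ B}
-- (one entry per pair (a,b)).
Δcount : {v : ℕ} → .{{_ : NonZero v}} → List (Fin v) → List (Fin v) → Fin v → ℕ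
Δcount A B g =
  length (filter (λ p → (proj₁ p ⊖ proj₂ p) ≟ g) (cartesianProduct A B))

ΔIsλG : {v : ℕ} → .{{_ : NonZero v}} → List (Fin v) → List (Fin v) → ℕ → Set
ΔIsλG A B λ' = ∀ g → Δcount A B g ≡ λ'

-- A subset of ℤ_v is a duplicate-free list; its size is its length.
-- Non-disjoint (v,m,k_1,…,k_m)-GPSEDF in ℤ_v (sets need not be disjoint):
-- |A_i| = k_i and Δ(A_i,A_j) = λ_{i,j} G with λ_{i,j} = k_i k_j / v for i ≠ j.
record IsGPSEDF (v m : ℕ) .{{_ : NonZero v}} (k : Fin m → ℕ)
                (A : Fin m → List (Fin v)) : Set where
  field
    unique : ∀ i → Unique (A i)
    size   : ∀ i → length (A i) ≡ k i
    diff   : ∀ i j → i ≢ j → ΔIsλG (A i) (A j) ((k i * k j) / v)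

module Submission where

-- Take A₁ = {x : x mod b < k₁}, which has k₁ elements in each of the a blocks of b consecutive
-- residues, and the interval A₂ = {0, …, k₂b − 1}. Since b ∣ v, membership in A₁ depends only on
-- x mod b. The number of pairs in A₁ × A₂ with difference g is #{y ∈ A₂ : g + y ∈ A₁}, i.e. the
-- number of y in the window [0, k₂b) with (g + y) mod b < k₁; the window consists of k₂ full
-- periods, each contributing k₁, so every g occurs k₁k₂ = |A₁||A₂|/v times. Likewise Δ(A₂, A₁)
-- counts the x ∈ A₂ with x − g ∈ A₁, a window starting at −g.

open import Defs
open import Data.Nat using (ℕ; zero; suc; _+_; _*_; _∸_; _≤_; _<_; NonZero; z≤n; s≤s; _%_; _/_)
open import Data.Nat.Properties
open import Data.Nat.DivMod
  using (m%n<n; m%n%n≡m%n; %-distribˡ-+; [m+n]%n≡m%n; m<n⇒m%n≡m; m∣n⇒o%n%m≡o%m; m*n/n≡m)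
open import Data.Nat.Divisibility using (n∣m*n)
open import Data.Nat.ListAction using (sum)
open import Data.Nat.ListAction.Properties using (sum-++)
open import Data.Nat.Solver using (module +-*-Solver)
open import Data.Fin using (Fin; toℕ; zero; suc)
open import Data.Fin.Properties using (toℕ-injective; toℕ<n; toℕ-fromℕ<) renaming (_≟_ to _≟ᶠ_)
open import Data.List using (List; _++_; map; filter; cartesianProduct; allFin; tabulate; length)
open import Data.List.Properties using (map-++; map-∘; map-cong; map-tabulate)
open import Data.List.Relation.Unary.Unique.Propositional.Properties using (filter⁺; allFin⁺)
open import Data.Product using (Σ; _×_; _,_; proj₁; proj₂)
open import Data.Bool using (true; false; if_then_else_)
open import Function using (_∘_; mk⇔)
open import Level using (Level)
open import Relation.Nullary using (Dec; does; contradiction)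
open import Relation.Nullary.Decidable using (does-⇔)
open import Relation.Unary using (Pred; Decidable)
open import Relation.Binary.PropositionalEquality
open ≡-Reasoning

private variable
  ℓ p q : Level
  X Y : Set
  P : Set p
  Q : Set q

χ : Dec P → ℕ
χ P? = if does P? then 1 else 0

χ-⇔ : (P → Q) → (Q → P) → (P? : Dec P) (Q? : Dec Q) → χ P? ≡ χ Q?
χ-⇔ P→Q Q→P P? Q? = cong (λ b → if b then 1 else 0) (does-⇔ (mk⇔ P→Q Q→P) P? Q?)

-- The list constructors are only opened here: the statement uses those of Data.Vec.Functional.
module ListSums where
  open import Data.List using ([]; _∷_)

  length-filter≡sum-χ : {R : Pred X ℓ} (R? : Decidable R) (xs : List X) →
    length (filter R? xs) ≡ sum (map (χ ∘ R?) xs)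
  length-filter≡sum-χ R? [] = refl
  length-filter≡sum-χ R? (x ∷ xs) with does (R? x)
  ... | true  = cong suc (length-filter≡sum-χ R? xs)
  ... | false = length-filter≡sum-χ R? xs

  sum-map-filter : {R : Pred X ℓ} (R? : Decidable R) (f : X → ℕ) (xs : List X) →
    sum (map f (filter R? xs)) ≡ sum (map (λ x → χ (R? x) * f x) xs)
  sum-map-filter R? f [] = refl
  sum-map-filter R? f (x ∷ xs) with does (R? x)
  ... | true  = cong₂ _+_ (sym (+-identityʳ (f x))) (sum-map-filter R? f xs)
  ... | false = sum-map-filter R? f xs

  sum-map-cartesianProduct : (f : X × Y → ℕ) (xs : List X) (ys : List Y) →
    sum (map f (cartesianProduct xs ys)) ≡ sum (map (λ x → sum (map (λ y → f (x , y)) ys)) xs)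
  sum-map-cartesianProduct f [] ys = refl
  sum-map-cartesianProduct f (x ∷ xs) ys = begin
    sum (map f (map (x ,_) ys ++ cartesianProduct xs ys))
      ≡⟨ cong sum (map-++ f (map (x ,_) ys) _) ⟩
    sum (map f (map (x ,_) ys) ++ map f (cartesianProduct xs ys))
      ≡⟨ sum-++ (map f (map (x ,_) ys)) _ ⟩
    sum (map f (map (x ,_) ys)) + sum (map f (cartesianProduct xs ys))
      ≡⟨ cong₂ _+_ (cong sum (sym (map-∘ ys))) (sum-map-cartesianProduct f xs ys) ⟩
    sum (map (λ y → f (x , y)) ys) + sum (map (λ x → sum (map (λ y → f (x , y)) ys)) xs) ∎

open ListSums

infix 10 ∑<
∑< : ℕ → (ℕ → ℕ) → ℕ
∑< zero    f = 0
∑< (suc n) f = f 0 + ∑< n (f ∘ suc)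

syntax ∑< n (λ i → e) = ∑[ i < n ] e

sum-tabulate-toℕ : ∀ n (f : ℕ → ℕ) → sum (tabulate {n = n} (f ∘ toℕ)) ≡ ∑[ i < n ] f i
sum-tabulate-toℕ zero    f = refl
sum-tabulate-toℕ (suc n) f = cong (f 0 +_) (sum-tabulate-toℕ n (f ∘ suc))

sum-map-allFin : ∀ n (f : ℕ → ℕ) → sum (map (f ∘ toℕ) (allFin n)) ≡ ∑[ i < n ] f i
sum-map-allFin n f = trans (cong sum (map-tabulate {n = n} (λ i → i) (f ∘ toℕ))) (sum-tabulate-toℕ n f)

∑-cong : ∀ n {f g : ℕ → ℕ} → (∀ i → i < n → f i ≡ g i) → ∑[ i < n ] f i ≡ ∑[ i < n ] g i
∑-cong zero    f≡g = refl
∑-cong (suc n) f≡g = cong₂ _+_ (f≡g 0 (s≤s z≤n)) (∑-cong n (λ i i<n → f≡g (suc i) (s≤s i<n)))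

∑-zero : ∀ n → ∑[ i < n ] 0 ≡ 0
∑-zero zero    = refl
∑-zero (suc n) = ∑-zero n

∑-split : ∀ m n (f : ℕ → ℕ) → ∑[ i < m + n ] f i ≡ ∑[ i < m ] f i + ∑[ i < n ] f (m + i)
∑-split zero    n f = refl
∑-split (suc m) n f = trans (cong (f 0 +_) (∑-split m n (f ∘ suc))) (sym (+-assoc (f 0) _ _))

∑-last : ∀ n (f : ℕ → ℕ) → ∑[ i < suc n ] f i ≡ ∑[ i < n ] f i + f n
∑-last zero    f = +-comm (f 0) 0
∑-last (suc n) f = trans (cong (f 0 +_) (∑-last n (f ∘ suc))) (sym (+-assoc (f 0) _ _))

∑-χ-< : ∀ {c n} → c ≤ n → ∑[ i < n ] χ (i <? c) ≡ c
∑-χ-< {n = n} z≤n = ∑-zero n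
∑-χ-< (s≤s c≤n) = cong suc (∑-χ-< c≤n)

∑-restrict : ∀ {c n} (f : ℕ → ℕ) → c ≤ n → ∑[ i < n ] (χ (i <? c) * f i) ≡ ∑[ i < c ] f i
∑-restrict {n = n} f z≤n = ∑-zero n
∑-restrict f (s≤s c≤n) = cong₂ _+_ (+-identityʳ (f 0)) (∑-restrict (f ∘ suc) c≤n)

∑-δ : ∀ {z n} (f : ℕ → ℕ) → z < n → ∑[ i < n ] (f i * χ (i ≟ z)) ≡ f z
∑-δ {zero} {suc n} f _ = begin
  f 0 * 1 + ∑[ i < n ] (f (suc i) * 0)
    ≡⟨ cong₂ _+_ (*-identityʳ (f 0)) (∑-cong n (λ i _ → *-zeroʳ (f (suc i)))) ⟩
  f 0 + ∑[ i < n ] 0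
    ≡⟨ cong (f 0 +_) (∑-zero n) ⟩
  f 0 + 0
    ≡⟨ +-identityʳ (f 0) ⟩
  f 0 ∎
∑-δ {suc z} {suc n} f (s≤s z<n) = cong₂ _+_ (*-zeroʳ (f 0)) (∑-δ (f ∘ suc) z<n)

Periodic : ℕ → (ℕ → ℕ) → Set
Periodic n f = ∀ i → f (i + n) ≡ f i

∑-rotate-once : ∀ n {f : ℕ → ℕ} → Periodic n f → ∑[ i < n ] f (suc i) ≡ ∑[ i < n ] f i
∑-rotate-once n {f} f-per = +-cancelˡ-≡ (f 0) _ _ (begin
  f 0 + ∑[ i < n ] f (suc i) ≡⟨ ∑-last n f ⟩
  ∑[ i < n ] f i + f n       ≡⟨ cong (∑[ i < n ] f i +_) (f-per 0) ⟩
  ∑[ i < n ] f i + f 0       ≡⟨ +-comm _ (f 0) ⟩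
  f 0 + ∑[ i < n ] f i       ∎)

∑-shift : ∀ n {f : ℕ → ℕ} → Periodic n f → ∀ s → ∑[ i < n ] f (s + i) ≡ ∑[ i < n ] f i
∑-shift n f-per zero    = refl
∑-shift n f-per (suc s) = trans (∑-shift n (f-per ∘ suc) s) (∑-rotate-once n f-per)

∑-periods : ∀ n {f : ℕ → ℕ} → Periodic n f → ∀ k → ∑[ i < k * n ] f i ≡ k * ∑[ i < n ] f i
∑-periods n         f-per zero    = refl
∑-periods n {f = f} f-per (suc k) = begin
  ∑[ i < n + k * n ] f i                        ≡⟨ ∑-split n (k * n) f ⟩
  ∑[ i < n ] f i + ∑[ i < k * n ] f (n + i)     ≡⟨ cong (∑[ i < n ] f i +_) (∑-cong (k * n) (λ i _ → f-per′ i)) ⟩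
  ∑[ i < n ] f i + ∑[ i < k * n ] f i           ≡⟨ cong (∑[ i < n ] f i +_) (∑-periods n f-per k) ⟩
  ∑[ i < n ] f i + k * ∑[ i < n ] f i           ∎
  where
  f-per′ : ∀ i → f (n + i) ≡ f i
  f-per′ i = trans (cong f (+-comm n i)) (f-per i)

∑-window : ∀ n {f : ℕ → ℕ} → Periodic n f → ∀ s k → ∑[ i < k * n ] f (s + i) ≡ k * ∑[ i < n ] f i
∑-window n {f} f-per s k = begin
  ∑[ i < k * n ] f (s + i)   ≡⟨ ∑-periods n (λ i → trans (cong f (sym (+-assoc s i n))) (f-per (s + i))) k ⟩
  k * ∑[ i < n ] f (s + i)   ≡⟨ cong (k *_) (∑-shift n f-per s) ⟩
  k * ∑[ i < n ] f i         ∎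

finSubset : ∀ n {R : Pred ℕ ℓ} → Decidable R → List (Fin n)
finSubset n R? = filter (R? ∘ toℕ) (allFin n)

sum-map-finSubset : ∀ n {R : Pred ℕ ℓ} (R? : Decidable R) (f : ℕ → ℕ) →
  sum (map (f ∘ toℕ) (finSubset n R?)) ≡ ∑[ i < n ] (χ (R? i) * f i)
sum-map-finSubset n R? f =
  trans (sum-map-filter (R? ∘ toℕ) (f ∘ toℕ) (allFin n)) (sum-map-allFin n (λ i → χ (R? i) * f i))

length-finSubset : ∀ n {R : Pred ℕ ℓ} (R? : Decidable R) → length (finSubset n R?) ≡ ∑[ i < n ] χ (R? i)
length-finSubset n R? = trans (length-filter≡sum-χ (R? ∘ toℕ) (allFin n)) (sum-map-allFin n (χ ∘ R?))

module _ {v : ℕ} .{{_ : NonZero v}} where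

  ∑-rotate : ∀ (f : ℕ → ℕ) s → ∑[ i < v ] f i ≡ ∑[ i < v ] f ((s + i) % v)
  ∑-rotate f s = begin
    ∑[ i < v ] f i              ≡⟨ ∑-cong v (λ i i<v → cong f (sym (m<n⇒m%n≡m i<v))) ⟩
    ∑[ i < v ] f (i % v)        ≡⟨ ∑-shift v (λ i → cong f ([m+n]%n≡m%n i v)) s ⟨
    ∑[ i < v ] f ((s + i) % v)  ∎

  [m%v+k]%v≡[m+k]%v : ∀ m k → (m % v + k) % v ≡ (m + k) % v
  [m%v+k]%v≡[m+k]%v m k = begin
    (m % v + k) % v          ≡⟨ %-distribˡ-+ (m % v) k v ⟩
    (m % v % v + k % v) % v  ≡⟨ cong (λ t → (t + k % v) % v) (m%n%n≡m%n m v) ⟩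
    (m % v + k % v) % v      ≡⟨ %-distribˡ-+ m k v ⟨
    (m + k) % v              ∎

  sub-add-mod : ∀ {x y} → x < v → y ≤ v → ((x + (v ∸ y)) % v + y) % v ≡ x
  sub-add-mod {x} {y} x<v y≤v = begin
    ((x + (v ∸ y)) % v + y) % v  ≡⟨ [m%v+k]%v≡[m+k]%v (x + (v ∸ y)) y ⟩
    (x + (v ∸ y) + y) % v        ≡⟨ cong (_% v) (+-assoc x (v ∸ y) y) ⟩
    (x + (v ∸ y + y)) % v        ≡⟨ cong (λ t → (x + t) % v) (m∸n+n≡m y≤v) ⟩
    (x + v) % v                  ≡⟨ [m+n]%n≡m%n x v ⟩
    x % v                        ≡⟨ m<n⇒m%n≡m x<v ⟩
    x                            ∎

  add-sub-mod : ∀ {x y} → x < v → y ≤ v → ((y + x) % v + (v ∸ y)) % v ≡ x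
  add-sub-mod {x} {y} x<v y≤v = begin
    ((y + x) % v + (v ∸ y)) % v  ≡⟨ [m%v+k]%v≡[m+k]%v (y + x) (v ∸ y) ⟩
    (y + x + (v ∸ y)) % v        ≡⟨ cong (λ t → (t + (v ∸ y)) % v) (+-comm y x) ⟩
    (x + y + (v ∸ y)) % v        ≡⟨ cong (_% v) (+-assoc x y (v ∸ y)) ⟩
    (x + (y + (v ∸ y))) % v      ≡⟨ cong (λ t → (x + t) % v) (m+[n∸m]≡n y≤v) ⟩
    (x + v) % v                  ≡⟨ [m+n]%n≡m%n x v ⟩
    x % v                        ≡⟨ m<n⇒m%n≡m x<v ⟩
    x                            ∎

  toℕ-⊖ : (x y : Fin v) → toℕ (x ⊖ y) ≡ (toℕ x + (v ∸ toℕ y)) % v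
  toℕ-⊖ x y = toℕ-fromℕ< (m%n<n (toℕ x + (v ∸ toℕ y)) v)

  ⊖-swap : {x y g : Fin v} → x ⊖ y ≡ g → x ⊖ g ≡ y
  ⊖-swap {x} {y} {g} x⊖y≡g = toℕ-injective (begin
    toℕ (x ⊖ g)                              ≡⟨ toℕ-⊖ x g ⟩
    (toℕ x + (v ∸ toℕ g)) % v                ≡⟨ cong (λ t → (t + (v ∸ toℕ g)) % v) x≡g+y ⟩
    ((toℕ g + toℕ y) % v + (v ∸ toℕ g)) % v  ≡⟨ add-sub-mod (toℕ<n y) (<⇒≤ (toℕ<n g)) ⟩
    toℕ y                                    ∎)
    where
    x≡g+y : toℕ x ≡ (toℕ g + toℕ y) % v
    x≡g+y = begin
      toℕ x                                    ≡⟨ sub-add-mod (toℕ<n x) (<⇒≤ (toℕ<n y)) ⟨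
      ((toℕ x + (v ∸ toℕ y)) % v + toℕ y) % v  ≡⟨ cong (λ t → (t + toℕ y) % v) (toℕ-⊖ x y) ⟨
      (toℕ (x ⊖ y) + toℕ y) % v                ≡⟨ cong (λ h → (toℕ h + toℕ y) % v) x⊖y≡g ⟩
      (toℕ g + toℕ y) % v                      ∎

  count-⊖ : ∀ {R : Pred ℕ ℓ} (R? : Decidable R) (x g : Fin v) →
    length (filter (λ y → x ⊖ y ≟ᶠ g) (finSubset v R?)) ≡ χ (R? ((toℕ x + (v ∸ toℕ g)) % v))
  count-⊖ R? x g = begin
    length (filter (λ y → x ⊖ y ≟ᶠ g) (finSubset v R?))
      ≡⟨ length-filter≡sum-χ (λ y → x ⊖ y ≟ᶠ g) (finSubset v R?) ⟩
    sum (map (λ y → χ (x ⊖ y ≟ᶠ g)) (finSubset v R?))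
      ≡⟨ cong sum (map-cong unique-solution (finSubset v R?)) ⟩
    sum (map (λ y → χ (toℕ y ≟ z)) (finSubset v R?))
      ≡⟨ sum-map-finSubset v R? (λ i → χ (i ≟ z)) ⟩
    ∑[ i < v ] (χ (R? i) * χ (i ≟ z))
      ≡⟨ ∑-δ (χ ∘ R?) (m%n<n (toℕ x + (v ∸ toℕ g)) v) ⟩
    χ (R? z) ∎
    where
    z : ℕ
    z = (toℕ x + (v ∸ toℕ g)) % v

    solution : ∀ y → x ⊖ y ≡ g → toℕ y ≡ z
    solution y x⊖y≡g = trans (cong toℕ (sym (⊖-swap x⊖y≡g))) (toℕ-⊖ x g)

    solution⁻¹ : ∀ y → toℕ y ≡ z → x ⊖ y ≡ g
    solution⁻¹ y y≡z = ⊖-swap (toℕ-injective (trans (toℕ-⊖ x g) (sym y≡z)))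

    unique-solution : ∀ y → χ (x ⊖ y ≟ᶠ g) ≡ χ (toℕ y ≟ z)
    unique-solution y = χ-⇔ (solution y) (solution⁻¹ y) (x ⊖ y ≟ᶠ g) (toℕ y ≟ z)

  Δcount-finSubset : ∀ {R S : Pred ℕ ℓ} (R? : Decidable R) (S? : Decidable S) (g : Fin v) →
    Δcount (finSubset v R?) (finSubset v S?) g ≡ ∑[ i < v ] (χ (R? i) * χ (S? ((i + (v ∸ toℕ g)) % v)))
  Δcount-finSubset R? S? g = begin
    length (filter (λ p → proj₁ p ⊖ proj₂ p ≟ᶠ g) (cartesianProduct A B))
      ≡⟨ length-filter≡sum-χ _ (cartesianProduct A B) ⟩
    sum (map (λ p → χ (proj₁ p ⊖ proj₂ p ≟ᶠ g)) (cartesianProduct A B))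
      ≡⟨ sum-map-cartesianProduct _ A B ⟩
    sum (map (λ x → sum (map (λ y → χ (x ⊖ y ≟ᶠ g)) B)) A)
      ≡⟨ cong sum (map-cong (λ x → trans (sym (length-filter≡sum-χ _ B)) (count-⊖ S? x g)) A) ⟩
    sum (map (λ x → χ (S? ((toℕ x + (v ∸ toℕ g)) % v))) A)
      ≡⟨ sum-map-finSubset v R? (λ i → χ (S? ((i + (v ∸ toℕ g)) % v))) ⟩
    ∑[ i < v ] (χ (R? i) * χ (S? ((i + (v ∸ toℕ g)) % v))) ∎
    where
    A B : List (Fin v)
    A = finSubset v R?
    B = finSubset v S?

open import Data.Vec.Functional using (_∷_; [])

module Construction (a b k₁ k₂ : ℕ) .{{_ : NonZero (a * b)}} (k₁≤b : k₁ ≤ b) (k₂≤a : k₂ ≤ a) where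

  instance
    b≢0 : NonZero b
    b≢0 = m*n≢0⇒n≢0 a

  v c : ℕ
  v = a * b
  c = k₂ * b

  residue<k₁? : Decidable (λ m → m % b < k₁)
  residue<k₁? m = m % b <? k₁

  A₁ A₂ : List (Fin v)
  A₁ = finSubset v residue<k₁?
  A₂ = finSubset v (_<? c)

  A : Fin 2 → List (Fin v)
  A = A₁ ∷ A₂ ∷ []

  k : Fin 2 → ℕ
  k = k₁ * a ∷ k₂ * b ∷ []

  𝟙A₁ : ℕ → ℕ
  𝟙A₁ = χ ∘ residue<k₁?

  𝟙A₁-periodic : Periodic b 𝟙A₁
  𝟙A₁-periodic i = cong (λ t → χ (t <? k₁)) ([m+n]%n≡m%n i b)

  ∑-𝟙A₁ : ∑[ i < b ] 𝟙A₁ i ≡ k₁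
  ∑-𝟙A₁ = trans (∑-cong b (λ i i<b → cong (λ t → χ (t <? k₁)) (m<n⇒m%n≡m i<b))) (∑-χ-< k₁≤b)

  c≤v : c ≤ v
  c≤v = *-monoˡ-≤ b k₂≤a

  %v%b≡%b : ∀ m → m % v % b ≡ m % b
  %v%b≡%b m = m∣n⇒o%n%m≡o%m b v m (n∣m*n a)

  𝟙A₁-window : ∀ s → ∑[ i < v ] (χ (i <? c) * 𝟙A₁ (s + i)) ≡ k₂ * k₁
  𝟙A₁-window s = begin
    ∑[ i < v ] (χ (i <? c) * 𝟙A₁ (s + i))  ≡⟨ ∑-restrict (λ i → 𝟙A₁ (s + i)) c≤v ⟩
    ∑[ i < k₂ * b ] 𝟙A₁ (s + i)           ≡⟨ ∑-window b 𝟙A₁-periodic s k₂ ⟩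
    k₂ * ∑[ i < b ] 𝟙A₁ i                  ≡⟨ cong (k₂ *_) ∑-𝟙A₁ ⟩
    k₂ * k₁                                ∎

  |A₁| : length A₁ ≡ k₁ * a
  |A₁| = begin
    length A₁             ≡⟨ length-finSubset v residue<k₁? ⟩
    ∑[ i < a * b ] 𝟙A₁ i  ≡⟨ ∑-periods b 𝟙A₁-periodic a ⟩
    a * ∑[ i < b ] 𝟙A₁ i  ≡⟨ cong (a *_) ∑-𝟙A₁ ⟩
    a * k₁                ≡⟨ *-comm a k₁ ⟩
    k₁ * a                ∎

  |A₂| : length A₂ ≡ k₂ * b
  |A₂| = trans (length-finSubset v (_<? c)) (∑-χ-< c≤v)

  Δ₁₂ : ∀ g → Δcount A₁ A₂ g ≡ k₂ * k₁
  Δ₁₂ g = begin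
    Δcount A₁ A₂ g
      ≡⟨ Δcount-finSubset residue<k₁? (_<? c) g ⟩
    ∑[ i < v ] (𝟙A₁ i * χ ((i + (v ∸ G)) % v <? c))
      ≡⟨ ∑-rotate _ G ⟩
    ∑[ j < v ] (𝟙A₁ ((G + j) % v) * χ (((G + j) % v + (v ∸ G)) % v <? c))
      ≡⟨ ∑-cong v rotated ⟩
    ∑[ j < v ] (χ (j <? c) * 𝟙A₁ (G + j))
      ≡⟨ 𝟙A₁-window G ⟩
    k₂ * k₁ ∎
    where
    G : ℕ
    G = toℕ g

    rotated : ∀ j → j < v →
      𝟙A₁ ((G + j) % v) * χ (((G + j) % v + (v ∸ G)) % v <? c) ≡ χ (j <? c) * 𝟙A₁ (G + j)
    rotated j j<v = trans
      (cong₂ (λ s t → χ (s <? k₁) * χ (t <? c)) (%v%b≡%b (G + j)) (add-sub-mod j<v (<⇒≤ (toℕ<n g))))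
      (*-comm (𝟙A₁ (G + j)) _)

  Δ₂₁ : ∀ g → Δcount A₂ A₁ g ≡ k₂ * k₁
  Δ₂₁ g = begin
    Δcount A₂ A₁ g
      ≡⟨ Δcount-finSubset (_<? c) residue<k₁? g ⟩
    ∑[ i < v ] (χ (i <? c) * 𝟙A₁ ((i + (v ∸ G)) % v))
      ≡⟨ ∑-cong v (λ i _ → cong (λ t → χ (i <? c) * χ (t <? k₁)) (reduce i)) ⟩
    ∑[ i < v ] (χ (i <? c) * 𝟙A₁ ((v ∸ G) + i))
      ≡⟨ 𝟙A₁-window (v ∸ G) ⟩
    k₂ * k₁ ∎
    where
    G : ℕ
    G = toℕ g

    reduce : ∀ i → (i + (v ∸ G)) % v % b ≡ ((v ∸ G) + i) % b
    reduce i = trans (%v%b≡%b (i + (v ∸ G))) (cong (_% b) (+-comm i (v ∸ G)))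

  λ₁₂ : k₁ * a * (k₂ * b) / v ≡ k₂ * k₁
  λ₁₂ = begin
    k₁ * a * (k₂ * b) / v  ≡⟨ cong (_/ v) (solve 4 (λ x y z w → x :* y :* (z :* w) := z :* x :* (y :* w)) refl k₁ a k₂ b) ⟩
    k₂ * k₁ * v / v        ≡⟨ m*n/n≡m (k₂ * k₁) v ⟩
    k₂ * k₁                ∎
    where open +-*-Solver

  λ₂₁ : k₂ * b * (k₁ * a) / v ≡ k₂ * k₁
  λ₂₁ = trans (cong (_/ v) (*-comm (k₂ * b) (k₁ * a))) λ₁₂

  Δ-uniform : ∀ i j → i ≢ j → ΔIsλG (A i) (A j) (k i * k j / v)
  Δ-uniform zero       zero       i≢j = contradiction refl i≢j
  Δ-uniform zero       (suc zero) _   g = trans (Δ₁₂ g) (sym λ₁₂)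
  Δ-uniform (suc zero) zero       _   g = trans (Δ₂₁ g) (sym λ₂₁)
  Δ-uniform (suc zero) (suc zero) i≢j = contradiction refl i≢j

  isGPSEDF : IsGPSEDF v 2 k A
  isGPSEDF = record
    { unique = λ { zero → filter⁺ _ (allFin⁺ v) ; (suc zero) → filter⁺ _ (allFin⁺ v) }
    ; size   = λ { zero → |A₁| ; (suc zero) → |A₂| }
    ; diff   = Δ-uniform
    }

theorem3p7 : (a b k₁ k₂ : ℕ) → .{{_ : NonZero (a * b)}} →
    1 ≤ k₁ → k₁ ≤ b ∸ 1 → 1 ≤ k₂ → k₂ ≤ a ∸ 1 →
    Σ (Fin 2 → List (Fin (a * b)))
      (IsGPSEDF (a * b) 2 (k₁ * a ∷ k₂ * b ∷ []))
theorem3p7 a b k₁ k₂ _ k₁≤b-1 _ k₂≤a-1 = A , isGPSEDF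
  where
  open Construction a b k₁ k₂ (≤-trans k₁≤b-1 (m∸n≤m b 1)) (≤-trans k₂≤a-1 (m∸n≤m a 1))
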